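{- There exists an algebra $\mathbf{D}=(D;\sqcap,\sqcup,\neg,\lrcorner,\top,\bot)$ of type $(2,2,1,1,0,0)$ that satisfies the identities (1a)–(4a), (1b)–(4b), (6a), (6b) and (7) listed below, but satisfies neither (5a) nor (5b).
   Context: Write $x\vee y:=\neg(\neg x\sqcap\neg y)$ and $x\wedge y:=\lrcorner(\lrcorner x\sqcup\lrcorner y)$. The identities (for all $x,y,z\in D$) are: (1a) $x\sqcap y=y\sqcap x$, (1b) $x\sqcup y=y\sqcup x$; (2a) $\neg(x\sqcap x)=\neg x$, (2b) $\lrcorner(x\sqcup x)=\lrcorner x$; (3a) $x\sqcap(x\sqcup y)=x\sqcap x$, (3b) $x\sqcup(x\sqcap y)=x\sqcup x$; (4a) $x\sqcap(y\vee z)=(x\sqcap y)\vee(x\sqcap z)$, (4b) $x\sqcup(y\wedge z)=(x\sqcup y)\wedge(x\sqcup z)$; (5a) $\neg\neg(x\sqcap y)=x\sqcap y$, (5b) $\lrcorner\lrcorner(x\sqcup y)=x\sqcup y$; (6a) $x\sqcap\neg x=\bot$, (6b) $x\sqcup\lrcorner x=\top$; (7) $(x\sqcap x)\sqcup(x\sqcap x)=(x\sqcup x)\sqcap(x\sqcup x)$. -}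

module Defs where

open import Relation.Binary.PropositionalEquality using (_≡_)

record Algebra : Set₁ where
  field
    Carrier : Set
    _⊓_ _⊔_ : Carrier → Carrier → Carrier
    ¬_ ⌟_ : Carrier → Carrier
    top bot : Carrier

  infixl 7 _⊓_
  infixl 6 _⊔_

  _∨_ : Carrier → Carrier → Carrier
  x ∨ y = ¬ ((¬ x) ⊓ (¬ y))

  _∧_ : Carrier → Carrier → Carrier
  x ∧ y = ⌟ ((⌟ x) ⊔ (⌟ y))

module _ (A : Algebra) where
  open Algebra A

  Id1a Id1b Id2a Id2b Id3a Id3b Id4a Id4b Id5a Id5b Id6a Id6b Id7 : Set
  Id1a = ∀ x y → x ⊓ y ≡ y ⊓ x
  Id1b = ∀ x y → x ⊔ y ≡ y ⊔ x
  Id2a = ∀ x → ¬ (x ⊓ x) ≡ ¬ x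
  Id2b = ∀ x → ⌟ (x ⊔ x) ≡ ⌟ x
  Id3a = ∀ x y → x ⊓ (x ⊔ y) ≡ x ⊓ x
  Id3b = ∀ x y → x ⊔ (x ⊓ y) ≡ x ⊔ x
  Id4a = ∀ x y z → x ⊓ (y ∨ z) ≡ (x ⊓ y) ∨ (x ⊓ z)
  Id4b = ∀ x y z → x ⊔ (y ∧ z) ≡ (x ⊔ y) ∧ (x ⊔ z)
  Id5a = ∀ x y → ¬ (¬ (x ⊓ y)) ≡ x ⊓ y
  Id5b = ∀ x y → ⌟ (⌟ (x ⊔ y)) ≡ x ⊔ y
  Id6a = ∀ x → x ⊓ (¬ x) ≡ bot
  Id6b = ∀ x → x ⊔ (⌟ x) ≡ top
  Id7 = ∀ x → (x ⊓ x) ⊔ (x ⊓ x) ≡ (x ⊔ x) ⊓ (x ⊔ x)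

{-# OPTIONS --safe #-}
module Submission where

-- Take a bounded lattice with ⊤ ≠ ⊥ and let both complements be constant: ¬ x = ⊥ and
-- ⌟ x = ⊤. Then x ∨ y = ⊥ and x ∧ y = ⊤, so (4a), (4b), (6a), (6b) all reduce to
-- x ⊓ ⊥ = ⊥ and x ⊔ ⊤ = ⊤, while (1)–(3) and (7) are lattice laws. But ¬ ¬ (⊤ ⊓ ⊤) = ⊥ ≠ ⊤
-- and ⌟ ⌟ (⊥ ⊔ ⊥) = ⊤ ≠ ⊥, so (5a) and (5b) fail. The two-element lattice is the witness.

open import Defs
open import Algebra.Core using (Op₂)
open import Algebra.Definitions using (RightZero)
open import Algebra.Lattice.Bundles using (Lattice)
open import Algebra.Lattice.Structures using (IsLattice)
import Algebra.Lattice.Properties.Lattice as LatticeProperties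
open import Data.Bool.Base using (true; false)
open import Data.Bool.Properties using (∨-∧-isLattice; ∧-zeroʳ; ∨-zeroʳ)
open import Data.Product using (Σ; _×_; _,_)
open import Level using (0ℓ)
open import Relation.Nullary using (¬_)
open import Relation.Binary.PropositionalEquality using (_≡_; _≢_; refl; sym; trans; module ≡-Reasoning)

module ConstantComplements
  {A : Set} {_⊔_ _⊓_ : Op₂ A} (isLattice : IsLattice _≡_ _⊔_ _⊓_)
  (⊤ ⊥ : A) (⊓-zeroʳ : RightZero _≡_ ⊥ _⊓_) (⊔-zeroʳ : RightZero _≡_ ⊤ _⊔_)
  where

  open IsLattice isLattice using (∧-comm; ∨-comm; ∧-absorbs-∨; ∨-absorbs-∧)

  lattice : Lattice 0ℓ 0ℓ
  lattice = record { isLattice = isLattice }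

  open LatticeProperties lattice
    using () renaming (∧-idem to ⊓-idem; ∨-idem to ⊔-idem)

  algebra : Algebra
  algebra = record
    { Carrier = A
    ; _⊓_ = _⊓_
    ; _⊔_ = _⊔_
    ; ¬_ = λ _ → ⊥
    ; ⌟_ = λ _ → ⊤
    ; top = ⊤
    ; bot = ⊥
    }

  id1a : Id1a algebra
  id1a = ∧-comm

  id1b : Id1b algebra
  id1b = ∨-comm

  id2a : Id2a algebra
  id2a _ = refl

  id2b : Id2b algebra
  id2b _ = refl

  id3a : Id3a algebra
  id3a x y = trans (∧-absorbs-∨ x y) (sym (⊓-idem x))

  id3b : Id3b algebra
  id3b x y = trans (∨-absorbs-∧ x y) (sym (⊔-idem x))

  id4a : Id4a algebra
  id4a x _ _ = ⊓-zeroʳ x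

  id4b : Id4b algebra
  id4b x _ _ = ⊔-zeroʳ x

  id6a : Id6a algebra
  id6a = ⊓-zeroʳ

  id6b : Id6b algebra
  id6b = ⊔-zeroʳ

  id7 : Id7 algebra
  id7 x = begin
    (x ⊓ x) ⊔ (x ⊓ x)  ≡⟨ ⊔-idem (x ⊓ x) ⟩
    x ⊓ x              ≡⟨ ⊓-idem x ⟩
    x                  ≡⟨ sym (⊔-idem x) ⟩
    x ⊔ x              ≡⟨ sym (⊓-idem (x ⊔ x)) ⟩
    (x ⊔ x) ⊓ (x ⊔ x)  ∎
    where open ≡-Reasoning

  ¬id5a : ⊤ ≢ ⊥ → ¬ Id5a algebra
  ¬id5a ⊤≢⊥ id5a = ⊤≢⊥ (sym (trans (id5a ⊤ ⊤) (⊓-idem ⊤)))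

  ¬id5b : ⊤ ≢ ⊥ → ¬ Id5b algebra
  ¬id5b ⊤≢⊥ id5b = ⊤≢⊥ (trans (id5b ⊥ ⊥) (⊔-idem ⊥))

open ConstantComplements ∨-∧-isLattice true false ∧-zeroʳ ∨-zeroʳ

theorem3p14 : Σ Algebra (λ D →
      Id1a D × Id2a D × Id3a D × Id4a D
    × Id1b D × Id2b D × Id3b D × Id4b D
    × Id6a D × Id6b D × Id7 D
    × ¬ Id5a D × ¬ Id5b D)
theorem3p14 =
  algebra , id1a , id2a , id3a , id4a , id1b , id2b , id3b , id4b , id6a , id6b , id7
  , ¬id5a true≢false , ¬id5b true≢false
  where
  true≢false : true ≢ false
  true≢false ()
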